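{- Let $p$ be a formal parameter and let $U=\begin{pmatrix} p & 1\\ 1 & 0\end{pmatrix}$. For every $x\in\mathbf Q^+$, the Taylor expansion at $p=0$ of $[x]_U=\sum_{n=0}^{\infty}a_np^n$ has integral coefficients, i.e. $a_n\in\mathbf Z$ for all $n$.
   Context: For $U=\begin{pmatrix} p & q\\ r & s\end{pmatrix}$, let $f_U:\mathbf Q^+\to\mathbf C$ be the unique solution of the system $f(1+x)=p\,f(x)+q\,f(1/x)$, $f\!\left(\frac{x}{1+x}\right)=r\,f(x)+s\,f(1/x)$ with $f(1)=1$ (existence and uniqueness follow by induction on the sum of the partial quotients of $x$). Define the $U$-deformation of $x\in\mathbf Q^+$ by $[x]_U:=\frac{f_U(x)}{f_U(1/x)}$. In the case $U=\begin{pmatrix} p & 1\\ 1 & 0\end{pmatrix}$ the system reads $f(1+x)=p\,f(x)+f(1/x)$, $f\!\left(\frac{x}{1+x}\right)=f(x)$; here $f_U(x)$ is a polynomial in $p$ with positive integer coefficients, and for $x=[n_0,n_1,\dots,n_k]$ (simple continued fraction) one has $[x]_U=\frac{1-p^{n_0}}{1-p}+\cfrac{p^{n_0}}{\frac{1-p^{n_1}}{1-p}+\cfrac{p^{n_1}}{\ddots+\cfrac{p^{n_{k-1}}}{\frac{1-p^{n_k}}{1-p}}}}$, a rational function of $p$. -}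

module Defs where

open import Data.Nat as ℕ using (ℕ; zero; suc; _+_; _∸_; compare; less; equal; greater)
open import Data.Integer as ℤ using (ℤ; 0ℤ; 1ℤ)
open import Data.Rational using (ℚ; ↥_; ↧ₙ_)

-- Polynomials / formal power series in p over ℤ, as coefficient sequences:
-- (c n) is the coefficient of p^n.
Series : Set
Series = ℕ → ℤ

zeroS : Series
zeroS _ = 0ℤ

oneS : Series
oneS zero    = 1ℤ
oneS (suc _) = 0ℤ

shiftS : Series → Series
shiftS c zero    = 0ℤ
shiftS c (suc n) = c n

_+S_ : Series → Series → Series
(c +S d) n = c n ℤ.+ d n

convAux : Series → Series → ℕ → ℕ → ℤ
convAux c d n zero    = c 0 ℤ.* d n
convAux c d n (suc i) = c (suc i) ℤ.* d (n ∸ suc i) ℤ.+ convAux c d n i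

conv : Series → Series → Series
conv c d n = convAux c d n n

-- f_U for U = (p 1; 1 0), evaluated at x = a/b (a, b > 0), as a polynomial in p.
-- It is the unique solution of
--   f(1+x) = p f(x) + f(1/x),  f(x/(1+x)) = f(x),  f(1) = 1,
-- computed by the subtractive Euclidean algorithm:
--   a = b      : x = 1,               f = 1
--   a = b+1+k  : x = 1 + (k+1)/b,     f = p f((k+1)/b) + f(b/(k+1))
--   b = a+1+k  : x = y/(1+y), y = a/(k+1),  f = f(a/(k+1))
-- The first argument is fuel (a + b suffices; each step lowers a + b).
fPair : ℕ → ℕ → ℕ → Series
fPair zero    a b = zeroS
fPair (suc fuel) a b with compare a b
... | less    .a k = fPair fuel a (suc k)
... | equal   .a   = oneS
... | greater .b k = shiftS (fPair fuel (suc k) b) +S fPair fuel b (suc k)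

-- f_U(x) and f_U(1/x) for a rational x (meaningful for x > 0)
fU : ℚ → Series
fU x = fPair (ℤ.∣ ↥ x ∣ + ↧ₙ x) ℤ.∣ ↥ x ∣ (↧ₙ x)

fUinv : ℚ → Series
fUinv x = fPair (ℤ.∣ ↥ x ∣ + ↧ₙ x) (↧ₙ x) ℤ.∣ ↥ x ∣

-- The constant term of f_U(1/x) is 1, since the subtractive Euclidean algorithm defining f_U
-- only ever adds p·f(y) + f(1/y) or keeps f(y), and it stops at f(1) = 1. A power series with
-- constant term 1 is a unit of ℤ[[p]], so f_U(x)/f_U(1/x) lies in ℤ[[p]].
module Submission where

open import Defs
open import Data.Nat using (ℕ)
open import Data.Integer using (ℤ)
open import Data.Rational using (ℚ; Positive)
open import Data.Product using (∃)
open import Relation.Binary.PropositionalEquality using (_≡_)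

open import Data.Nat using (zero; suc; _+_; _≤_; compare; less; equal; greater; z≤n; s≤s)
open import Data.Nat.Properties
  using (≤-refl; ≤-pred; ≤-trans; <⇒≤; ≤-reflexive; +-comm; +-∸-assoc; n∸n≡0; +-monoʳ-<; +-suc; m≤n+m; m<m+n)
open import Data.Integer as ℤ using (1ℤ; +_)
open import Data.Integer.Properties using (+-identityˡ; *-identityˡ)
open import Data.Integer.Tactic.RingSolver using (solve-∀)
open import Data.Rational using (mkℚ)
open import Data.Product using (_,_)
open import Relation.Binary.PropositionalEquality using (refl; trans; cong; cong₂; module ≡-Reasoning)

fPair-constant : ∀ fuel a b → suc a + suc b ≤ fuel → fPair fuel (suc a) (suc b) 0 ≡ 1ℤ
fPair-constant (suc fuel) a b ≤fuel with compare (suc a) (suc b)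
... | less .(suc a) k = fPair-constant fuel a k
  (≤-trans (+-monoʳ-< a (s≤s (s≤s (m≤n+m k a)))) (≤-pred ≤fuel))
... | equal .(suc a) = refl
... | greater .(suc b) k = trans (+-identityˡ _) (fPair-constant fuel b k
  (≤-trans (≤-reflexive (cong suc (+-suc b k))) (≤-trans (m<m+n (suc (b + k)) (s≤s z≤n)) (≤-pred ≤fuel))))

tailS : Series → Series
tailS c n = c (suc n)

-- Long division by c (correct when c 0 = 1): once the constant term d 0 of the quotient is
-- fixed, what is left to divide is (d − (d 0)·c)/p.
remainder : Series → Series → Series
remainder c d m = d (suc m) ℤ.- c (suc m) ℤ.* d 0

divide : Series → Series → Series
divide c d zero    = d 0
divide c d (suc n) = divide c (remainder c d) n

convAux-tail : ∀ c q n i → i ≤ n → convAux c q (suc n) i ≡ convAux c (tailS q) n i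
convAux-tail c q n zero    i≤n = refl
convAux-tail c q n (suc i) i<n =
  cong₂ ℤ._+_ (cong (λ k → c (suc i) ℤ.* q k) (+-∸-assoc 1 i<n))
              (convAux-tail c q n i (<⇒≤ i<n))

conv-suc : ∀ c q n → conv c q (suc n) ≡ c (suc n) ℤ.* q 0 ℤ.+ conv c (tailS q) n
conv-suc c q n =
  cong₂ ℤ._+_ (cong (λ k → c (suc n) ℤ.* q k) (n∸n≡0 n)) (convAux-tail c q n n ≤-refl)

conv-divide : ∀ c → c 0 ≡ 1ℤ → ∀ d n → conv c (divide c d) n ≡ d n
conv-divide c c₀≡1 d zero = trans (cong (ℤ._* d 0) c₀≡1) (*-identityˡ (d 0))
conv-divide c c₀≡1 d (suc n) = begin
  conv c (divide c d) (suc n)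
    ≡⟨ conv-suc c (divide c d) n ⟩
  c (suc n) ℤ.* d 0 ℤ.+ conv c (divide c (remainder c d)) n
    ≡⟨ cong (ℤ._+_ (c (suc n) ℤ.* d 0)) (conv-divide c c₀≡1 (remainder c d) n) ⟩
  c (suc n) ℤ.* d 0 ℤ.+ (d (suc n) ℤ.- c (suc n) ℤ.* d 0)
    ≡⟨ cancel (c (suc n) ℤ.* d 0) (d (suc n)) ⟩
  d (suc n) ∎
  where
  open ≡-Reasoning
  cancel : ∀ u v → u ℤ.+ (v ℤ.- u) ≡ v
  cancel = solve-∀

theorem1 : (x : ℚ) → Positive x →
    ∃ λ (a : ℕ → ℤ) → ∀ n → conv (fUinv x) a n ≡ fU x n
theorem1 x@(mkℚ (+ suc n) d _) _ = divide (fUinv x) (fU x) , conv-divide (fUinv x) c₀≡1 (fU x)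
  where
  c₀≡1 : fUinv x 0 ≡ 1ℤ
  c₀≡1 = fPair-constant (suc n + suc d) d n (≤-reflexive (+-comm (suc d) (suc n)))
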